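{- Let $P\colon\mathcal C^{op}\to\mathbf{InfSL}$ be an elementary existential doctrine, and let $\Gamma_P\colon\mathcal C\to\mathcal A_P$ be its graph functor. Then (i) $\Gamma_P$ is strict monoidal (from $(\mathcal C,\times,I)$ to $(\mathcal A_P,\otimes,I)$); (ii) for every $f\colon X\to Y$ in $\mathcal C$, $\Gamma_P(f)$ has a right adjoint in $\mathcal A_P$, namely $P_{\mathrm{id}_Y\times f}(\delta_Y)\in P(Y\times X)$, i.e. $\delta_X\le\Gamma_P(f);P_{\mathrm{id}_Y\times f}(\delta_Y)$ and $P_{\mathrm{id}_Y\times f}(\delta_Y);\Gamma_P(f)\le\delta_Y$. Consequently $\Gamma_P$ corestricts to a strict cartesian functor $\Gamma_P\colon\mathcal C\to\mathrm{Map}(\mathcal A_P)$.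
   Context: $\mathcal C$ is a cartesian category with chosen products $\times$, projections $\pi_i$, pairing $\langle-,-\rangle$, terminal object $I$, diagonals $\Delta_A$ and unique maps $!_A$. $\mathbf{InfSL}$ is the category of meet-semilattices with top and finite-meet-preserving maps; $P_f$ denotes $P(f)$. $P$ is an elementary existential doctrine: there are $\delta_A\in P(A\times A)$ such that for $e=\mathrm{id}_X\times\Delta_A\colon X\times A\to X\times A\times A$, $P_e$ has left adjoint $\exists_e(\alpha)=P_{\langle\pi_1,\pi_2\rangle}(\alpha)\wedge P_{\langle\pi_2,\pi_3\rangle}(\delta_A)$; for every product projection $\pi$, $P_\pi$ has a left adjoint $\exists_\pi$, satisfying Beck–Chevalley (for any projection $\pi\colon X\times A\to A$ and pullback $\pi f'=f\pi'$ with $\pi'\colon X'\to A'$, $\exists_{\pi'}P_{f'}=P_f\exists_\pi$) and Frobenius reciprocity ($\exists_\pi(P_\pi(\alpha)\wedge\beta)=\alpha\wedge\exists_\pi(\beta)$). The category $\mathcal A_P$: objects are those of $\mathcal C$; $\mathrm{Hom}_{\mathcal A_P}(X,Y)=P(X\times Y)$ with its order; identity on $X$ is $\delta_X$; for $f\in P(X\times Y)$, $g\in P(Y\times Z)$, the composite is $f;g=\exists_{\langle\pi_1,\pi_3\rangle}\big(P_{\langle\pi_1,\pi_2\rangle}(f)\wedge P_{\langle\pi_2,\pi_3\rangle}(g)\big)$ with projections out of $X\times Y\times Z$. Monoidal product: $\times$ on objects, and for $f\in P(A\times B)$, $g\in P(C\times D)$, $f\otimes g=P_{\langle\pi_1,\pi_3\rangle}(f)\wedge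 P_{\langle\pi_2,\pi_4\rangle}(g)\in P(A\times C\times B\times D)$. The graph functor $\Gamma_P$ is the identity on objects and sends $f\colon X\to Y$ to $\Gamma_P(f)=P_{f\times\mathrm{id}_Y}(\delta_Y)\in P(X\times Y)$. The associator, unitors and symmetry of $\mathcal A_P$ are the images under $\Gamma_P$ of those of $\mathcal C$, and each object $X$ carries the comonoid $\Gamma_P(\Delta_X),\Gamma_P(!_X)$; with this structure $\mathcal A_P$ is a cartesian bicategory. In a cartesian bicategory (poset-enriched symmetric monoidal category with comonoids $d_X,e_X$), a map is a morphism $f$ with $f;d_Y=d_X;(f\otimes f)$ and $f;e_Y=e_X$; maps form a cartesian category $\mathrm{Map}(-)$ with product $\otimes$. A strict cartesian functor is a functor preserving chosen products, projections and terminal object on the nose. -}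

module Defs where

open import Level using (Level; _⊔_) renaming (suc to lsuc)
open import Data.Product using (Σ; _×_; _,_)
open import Relation.Binary.PropositionalEquality using (_≡_)
open import Relation.Binary.Lattice.Bundles using (BoundedMeetSemilattice)

record CartesianCategory (o m : Level) : Set (lsuc (o ⊔ m)) where
  infixr 9 _∘_
  infixr 7 _⊗₀_
  field
    Obj  : Set o
    _⇒_  : Obj → Obj → Set m
    id   : ∀ {A} → A ⇒ A
    _∘_  : ∀ {A B C} → B ⇒ C → A ⇒ B → A ⇒ C
    identityˡ : ∀ {A B} {f : A ⇒ B} → id ∘ f ≡ f
    identityʳ : ∀ {A B} {f : A ⇒ B} → f ∘ id ≡ f
    assoc     : ∀ {A B C D} {f : A ⇒ B} {g : B ⇒ C} {h : C ⇒ D} →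
                (h ∘ g) ∘ f ≡ h ∘ (g ∘ f)
    _⊗₀_  : Obj → Obj → Obj
    π₁    : ∀ {A B} → (A ⊗₀ B) ⇒ A
    π₂    : ∀ {A B} → (A ⊗₀ B) ⇒ B
    ⟨_,_⟩ : ∀ {X A B} → X ⇒ A → X ⇒ B → X ⇒ (A ⊗₀ B)
    π₁-β  : ∀ {X A B} {f : X ⇒ A} {g : X ⇒ B} → π₁ ∘ ⟨ f , g ⟩ ≡ f
    π₂-β  : ∀ {X A B} {f : X ⇒ A} {g : X ⇒ B} → π₂ ∘ ⟨ f , g ⟩ ≡ g
    ⟨⟩-η  : ∀ {X A B} {h : X ⇒ (A ⊗₀ B)} → ⟨ π₁ ∘ h , π₂ ∘ h ⟩ ≡ h
    I      : Obj
    !      : ∀ {A} → A ⇒ I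
    !-uniq : ∀ {A} {f : A ⇒ I} → f ≡ !

  infixr 8 _⁂_
  _⁂_ : ∀ {A B C D} → A ⇒ B → C ⇒ D → (A ⊗₀ C) ⇒ (B ⊗₀ D)
  f ⁂ g = ⟨ f ∘ π₁ , g ∘ π₂ ⟩

  Δ : ∀ {A} → A ⇒ (A ⊗₀ A)
  Δ = ⟨ id , id ⟩

  IsPullback : ∀ {W B C D} → W ⇒ B → W ⇒ C → B ⇒ D → C ⇒ D → Set (o ⊔ m)
  IsPullback {W} {B} {C} p q f g =
    (f ∘ p ≡ g ∘ q) ×
    (∀ {V} (h : V ⇒ B) (k : V ⇒ C) → f ∘ h ≡ g ∘ k →
       Σ (V ⇒ W) λ u → (p ∘ u ≡ h) × (q ∘ u ≡ k) ×
         (∀ (u' : V ⇒ W) → p ∘ u' ≡ h → q ∘ u' ≡ k → u' ≡ u))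

record ElementaryExistentialDoctrine {o m} (𝒞 : CartesianCategory o m)
         (p ℓ₁ ℓ₂ : Level) : Set (lsuc (o ⊔ m ⊔ p ⊔ ℓ₁ ⊔ ℓ₂)) where
  open CartesianCategory 𝒞
  field
    P : Obj → BoundedMeetSemilattice p ℓ₁ ℓ₂

  module Fib (A : Obj) = BoundedMeetSemilattice (P A)
  open Fib using (Carrier; _≈_; _≤_; _∧_; ⊤)

  field
    reindex      : ∀ {A B} → A ⇒ B → Carrier B → Carrier A
    reindex-cong : ∀ {A B} (f : A ⇒ B) {x y : Carrier B} →
                   _≈_ B x y → _≈_ A (reindex f x) (reindex f y)
    reindex-mono : ∀ {A B} (f : A ⇒ B) {x y : Carrier B} →
                   _≤_ B x y → _≤_ A (reindex f x) (reindex f y)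
    reindex-∧    : ∀ {A B} (f : A ⇒ B) (x y : Carrier B) →
                   _≈_ A (reindex f (_∧_ B x y)) (_∧_ A (reindex f x) (reindex f y))
    reindex-⊤    : ∀ {A B} (f : A ⇒ B) → _≈_ A (reindex f (⊤ B)) (⊤ A)
    reindex-id   : ∀ {A} (x : Carrier A) → _≈_ A (reindex (id {A}) x) x
    reindex-∘    : ∀ {A B C} (f : A ⇒ B) (g : B ⇒ C) (x : Carrier C) →
                   _≈_ A (reindex (g ∘ f) x) (reindex f (reindex g x))

    δ : ∀ A → Carrier (A ⊗₀ A)
    -- for e = id_X × Δ_A : X × A → X × (A × A), P_e has left adjoint
    -- ∃_e α = P_⟨π₁,π₂⟩ α ∧ P_⟨π₂,π₃⟩ δ_A  (triples nested as X × (A × A))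
    ∃e-adj : ∀ {X A} (α : Carrier (X ⊗₀ A)) (β : Carrier (X ⊗₀ (A ⊗₀ A))) →
      let e   = id {X} ⁂ Δ {A}
          ∃eα = _∧_ (X ⊗₀ (A ⊗₀ A))
                  (reindex ⟨ π₁ , π₁ ∘ π₂ ⟩ α)
                  (reindex ⟨ π₁ ∘ π₂ , π₂ ∘ π₂ ⟩ (δ A))
      in (_≤_ _ ∃eα β → _≤_ _ α (reindex e β)) ×
         (_≤_ _ α (reindex e β) → _≤_ _ ∃eα β)

    ∃₁ : ∀ {A X} → Carrier (A ⊗₀ X) → Carrier A
    ∃₂ : ∀ {X A} → Carrier (X ⊗₀ A) → Carrier A
    ∃₁-adj : ∀ {A X} (β : Carrier (A ⊗₀ X)) (α : Carrier A) →
      (_≤_ A (∃₁ β) α → _≤_ _ β (reindex π₁ α)) ×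
      (_≤_ _ β (reindex π₁ α) → _≤_ A (∃₁ β) α)
    ∃₂-adj : ∀ {X A} (β : Carrier (X ⊗₀ A)) (α : Carrier A) →
      (_≤_ A (∃₂ β) α → _≤_ _ β (reindex π₂ α)) ×
      (_≤_ _ β (reindex π₂ α) → _≤_ A (∃₂ β) α)

    BC₂ : ∀ {X A X' A'} (f : A' ⇒ A) (f' : (X' ⊗₀ A') ⇒ (X ⊗₀ A)) →
          IsPullback f' π₂ π₂ f → (α : Carrier (X ⊗₀ A)) →
          _≈_ A' (∃₂ (reindex f' α)) (reindex f (∃₂ α))
    BC₁ : ∀ {A X A' X'} (f : A' ⇒ A) (f' : (A' ⊗₀ X') ⇒ (A ⊗₀ X)) →
          IsPullback f' π₁ π₁ f → (α : Carrier (A ⊗₀ X)) →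
          _≈_ A' (∃₁ (reindex f' α)) (reindex f (∃₁ α))

    Frob₁ : ∀ {A X} (α : Carrier A) (β : Carrier (A ⊗₀ X)) →
            _≈_ A (∃₁ (_∧_ _ (reindex π₁ α) β)) (_∧_ A α (∃₁ β))
    Frob₂ : ∀ {X A} (α : Carrier A) (β : Carrier (X ⊗₀ A)) →
            _≈_ A (∃₂ (_∧_ _ (reindex π₂ α) β)) (_∧_ A α (∃₂ β))

module Relations {o m p ℓ₁ ℓ₂} {𝒞 : CartesianCategory o m}
                 (D : ElementaryExistentialDoctrine 𝒞 p ℓ₁ ℓ₂) where
  open CartesianCategory 𝒞
  open ElementaryExistentialDoctrine D
  open Fib using (Carrier; _≈_; _≤_; _∧_)

  Hom : Obj → Obj → Set p
  Hom X Y = Carrier (X ⊗₀ Y)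

  _≤ᴬ_ : ∀ {X Y} → Hom X Y → Hom X Y → Set ℓ₂
  _≤ᴬ_ {X} {Y} = _≤_ (X ⊗₀ Y)
  _≈ᴬ_ : ∀ {X Y} → Hom X Y → Hom X Y → Set ℓ₁
  _≈ᴬ_ {X} {Y} = _≈_ (X ⊗₀ Y)
  infix 4 _≤ᴬ_ _≈ᴬ_

  idᴬ : ∀ X → Hom X X
  idᴬ X = δ X

  -- composite f ; g = ∃_⟨π₁,π₃⟩ (P_⟨π₁,π₂⟩ f ∧ P_⟨π₂,π₃⟩ g).
  -- The existential along ⟨π₁,π₃⟩ : X × Y × Z → X × Z is computed as
  -- the existential along the projection π₁ : (X × Z) × Y → X × Z,
  -- i.e. the triple product is taken in the order (X × Z) × Y.
  infixl 6 _⨾_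
  _⨾_ : ∀ {X Y Z} → Hom X Y → Hom Y Z → Hom X Z
  _⨾_ {X} {Y} {Z} f g =
    ∃₁ {X ⊗₀ Z} {Y}
       (_∧_ ((X ⊗₀ Z) ⊗₀ Y)
          (reindex ⟨ π₁ ∘ π₁ , π₂ ⟩ f)
          (reindex ⟨ π₂ , π₂ ∘ π₁ ⟩ g))

  infixr 7 _⊗ᴬ_
  _⊗ᴬ_ : ∀ {A B C D} → Hom A B → Hom C D → Hom (A ⊗₀ C) (B ⊗₀ D)
  _⊗ᴬ_ {A} {B} {C} {D} f g =
    _∧_ ((A ⊗₀ C) ⊗₀ (B ⊗₀ D))
      (reindex ⟨ π₁ ∘ π₁ , π₁ ∘ π₂ ⟩ f)
      (reindex ⟨ π₂ ∘ π₁ , π₂ ∘ π₂ ⟩ g)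

  Γ : ∀ {X Y} → X ⇒ Y → Hom X Y
  Γ {X} {Y} f = reindex (f ⁂ id {Y}) (δ Y)

  Γ* : ∀ {X Y} → X ⇒ Y → Hom Y X
  Γ* {X} {Y} f = reindex (id {Y} ⁂ f) (δ Y)

  dᴬ : ∀ X → Hom X (X ⊗₀ X)
  dᴬ X = Γ (Δ {X})
  eᴬ : ∀ X → Hom X I
  eᴬ X = Γ (! {X})

  IsMap : ∀ {X Y} → Hom X Y → Set ℓ₁
  IsMap {X} {Y} f = (f ⨾ dᴬ Y ≈ᴬ dᴬ X ⨾ (f ⊗ᴬ f)) × (f ⨾ eᴬ Y ≈ᴬ eᴬ X)

  -- projections of the product ⊗ in Map(A_P):
  -- p₁ = (id ⊗ e_B) ; ρ_A   and   p₂ = (e_A ⊗ id) ; λ_B,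
  -- with unitors ρ_A = Γ(π₁ : A × I → A), λ_B = Γ(π₂ : I × B → B)
  mapπ₁ : ∀ A B → Hom (A ⊗₀ B) A
  mapπ₁ A B = (idᴬ A ⊗ᴬ eᴬ B) ⨾ Γ (π₁ {A} {I})
  mapπ₂ : ∀ A B → Hom (A ⊗₀ B) B
  mapπ₂ A B = (eᴬ A ⊗ᴬ idᴬ B) ⨾ Γ (π₂ {I} {B})

  -- On objects Γ_P is the identity, ⊗ on objects of A_P is × and the
  -- unit is I, so the object parts hold definitionally; the structural
  -- isomorphisms of A_P are by definition Γ_P of those of C.
  StrictMonoidalGraph : Set (o ⊔ m ⊔ ℓ₁)
  StrictMonoidalGraph =
    (∀ {X} → Γ (id {X}) ≈ᴬ idᴬ X) ×
    (∀ {X Y Z} (f : X ⇒ Y) (g : Y ⇒ Z) → Γ (g ∘ f) ≈ᴬ Γ f ⨾ Γ g) ×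
    (∀ {A B C D} (f : A ⇒ B) (g : C ⇒ D) → Γ (f ⁂ g) ≈ᴬ Γ f ⊗ᴬ Γ g)

  GraphRightAdjoints : Set (o ⊔ m ⊔ ℓ₂)
  GraphRightAdjoints =
    ∀ {X Y} (f : X ⇒ Y) →
      (idᴬ X ≤ᴬ Γ f ⨾ Γ* f) × (Γ* f ⨾ Γ f ≤ᴬ idᴬ Y)

  StrictCartesianIntoMap : Set (o ⊔ m ⊔ ℓ₁)
  StrictCartesianIntoMap =
    (∀ {X Y} (f : X ⇒ Y) → IsMap (Γ f)) ×
    (∀ {A B} → Γ (π₁ {A} {B}) ≈ᴬ mapπ₁ A B) ×
    (∀ {A B} → Γ (π₂ {A} {B}) ≈ᴬ mapπ₂ A B) ×
    (∀ {X} → Γ (! {X}) ≈ᴬ eᴬ X)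

-- Work in the internal language of P, writing s ≐ t for the reindexing of δ
-- along ⟨ s , t ⟩. The adjunction ∃_e ⊣ P_e makes ≐ a Leibniz equality,
-- φ(s) ∧ s ≐ t ≤ φ(t), so it is reflexive, transitive, preserved by
-- composition and componentwise on products. The graph Γ f is f ∘ π₁ ≐ π₂ and
-- a composite of relations is an existential over the middle variable, so (i)
-- and (ii) follow by introducing that existential with the witness f x and
-- eliminating it by transitivity. Being a map and preserving projections is
-- then functoriality and monoidality of Γ applied to Δ ∘ f = (f ⁂ f) ∘ Δ,
-- ! ∘ f = !, π₁ = π₁ ∘ (id ⁂ !) and π₂ = π₂ ∘ (! ⁂ id).

module Submission where

open import Defs
open import Level using (Level)
open import Data.Product using (_×_; _,_; proj₁; proj₂)
open import Relation.Binary.PropositionalEquality as ≡ using (_≡_; cong; cong₂)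
import Relation.Binary.Lattice.Properties.MeetSemilattice as MeetSemilatticeProperties
import Relation.Binary.Reasoning.PartialOrder as PosetReasoning

module CartesianProperties {o m} (𝒞 : CartesianCategory o m) where
  open CartesianCategory 𝒞

  pullˡ : ∀ {A B C D} {a : C ⇒ D} {b : B ⇒ C} {c : B ⇒ D} {h : A ⇒ B} →
          a ∘ b ≡ c → a ∘ b ∘ h ≡ c ∘ h
  pullˡ {h = h} e = ≡.trans (≡.sym assoc) (cong (_∘ h) e)

  pullʳ : ∀ {A B C D} {a : C ⇒ D} {b : B ⇒ C} {c : A ⇒ C} {h : A ⇒ B} →
          b ∘ h ≡ c → (a ∘ b) ∘ h ≡ a ∘ c
  pullʳ {a = a} e = ≡.trans assoc (cong (a ∘_) e)

  ⟨⟩∘ : ∀ {W X A B} {f : X ⇒ A} {g : X ⇒ B} {h : W ⇒ X} →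
        ⟨ f , g ⟩ ∘ h ≡ ⟨ f ∘ h , g ∘ h ⟩
  ⟨⟩∘ = ≡.trans (≡.sym ⟨⟩-η) (cong₂ ⟨_,_⟩ (pullˡ π₁-β) (pullˡ π₂-β))

  ⟨π₁,π₂⟩≡id : ∀ {A B} → ⟨ π₁ , π₂ ⟩ ≡ id {A ⊗₀ B}
  ⟨π₁,π₂⟩≡id = ≡.trans (cong₂ ⟨_,_⟩ (≡.sym identityʳ) (≡.sym identityʳ)) ⟨⟩-η

  ∘π₁-⟨id,⟩ : ∀ {A B C} {f : A ⇒ C} {x : A ⇒ B} → (f ∘ π₁) ∘ ⟨ id , x ⟩ ≡ f
  ∘π₁-⟨id,⟩ = ≡.trans (pullʳ π₁-β) identityʳ

  ⁂∘⟨⟩ : ∀ {X A B C D} {f : A ⇒ C} {g : B ⇒ D} {a : X ⇒ A} {b : X ⇒ B} →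
         (f ⁂ g) ∘ ⟨ a , b ⟩ ≡ ⟨ f ∘ a , g ∘ b ⟩
  ⁂∘⟨⟩ = ≡.trans ⟨⟩∘ (cong₂ ⟨_,_⟩ (pullʳ π₁-β) (pullʳ π₂-β))

  Δ-natural : ∀ {X Y} {f : X ⇒ Y} → Δ ∘ f ≡ (f ⁂ f) ∘ Δ
  Δ-natural = ≡.trans ⟨⟩∘ (≡.trans (cong₂ ⟨_,_⟩ identityˡ identityˡ)
                (≡.sym (≡.trans ⁂∘⟨⟩ (cong₂ ⟨_,_⟩ identityʳ identityʳ))))

module GraphFunctor {o m p ℓ₁ ℓ₂} {𝒞 : CartesianCategory o m}
                    (D : ElementaryExistentialDoctrine 𝒞 p ℓ₁ ℓ₂) where
  open CartesianCategory 𝒞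
  open CartesianProperties 𝒞
  open ElementaryExistentialDoctrine D
  open Relations D

  module Fibre (A : Obj) where
    open Fib A public
    open MeetSemilatticeProperties meetSemilattice public using (∧-monotonic; ∧-cong)
    open PosetReasoning poset public

  infix 8 _≐_
  _≐_ : ∀ {Z A} → Z ⇒ A → Z ⇒ A → Fib.Carrier Z
  s ≐ t = reindex ⟨ s , t ⟩ (δ _)

  module _ {Y Z : Obj} where
    open Fibre Y

    reindex-reindex : ∀ {W} {u : Y ⇒ Z} {v : Z ⇒ W} {h : Y ⇒ W} {x : Fib.Carrier W} →
                      v ∘ u ≡ h → reindex u (reindex v x) ≈ reindex h x
    reindex-reindex {u = u} {v} {x = x} e =
      Eq.trans (Eq.sym (reindex-∘ u v x)) (Eq.reflexive (cong (λ h → reindex h x) e))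

    reindex-≐ : ∀ {A} (u : Y ⇒ Z) {s t : Z ⇒ A} {s' t' : Y ⇒ A} →
                s ∘ u ≡ s' → t ∘ u ≡ t' → reindex u (s ≐ t) ≈ s' ≐ t'
    reindex-≐ u e₁ e₂ = reindex-reindex (≡.trans ⟨⟩∘ (cong₂ ⟨_,_⟩ e₁ e₂))

  δ≈π₁≐π₂ : ∀ {A} → Fib._≈_ (A ⊗₀ A) (δ A) (π₁ ≐ π₂)
  δ≈π₁≐π₂ {A} = Eq.sym (Eq.trans (Eq.reflexive (cong (λ h → reindex h (δ A)) ⟨π₁,π₂⟩≡id))
                                 (reindex-id (δ A)))
    where open Fibre (A ⊗₀ A)

  module _ {Z A : Obj} where
    private
      e : (Z ⊗₀ A) ⇒ (Z ⊗₀ (A ⊗₀ A))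
      e = id ⁂ Δ

    module _ where
      open Fibre (Z ⊗₀ A)

      ⊤≤π₂≐π₂ : ⊤ ≤ π₂ ≐ π₂
      ⊤≤π₂≐π₂ = begin
        ⊤                                ≤⟨ proj₁ (∃e-adj ⊤ (π₁ ∘ π₂ ≐ π₂ ∘ π₂)) (Fib.x∧y≤y _ _ _) ⟩
        reindex e (π₁ ∘ π₂ ≐ π₂ ∘ π₂)    ≈⟨ reindex-≐ e (π∘π₂∘e π₁-β) (π∘π₂∘e π₂-β) ⟩
        π₂ ≐ π₂                          ∎
        where
        π∘π₂∘e : ∀ {π : (A ⊗₀ A) ⇒ A} → π ∘ Δ ≡ id → (π ∘ π₂) ∘ e ≡ π₂
        π∘π₂∘e πΔ = ≡.trans (pullʳ π₂-β) (≡.trans (pullˡ πΔ) identityˡ)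

    module _ where
      open Fibre (Z ⊗₀ (A ⊗₀ A))

      -- The counit of ∃_e ⊣ P_e at φ, because dropping the middle variable is a retraction of e.
      δ-subst : (φ : Fib.Carrier (Z ⊗₀ A)) →
                reindex ⟨ π₁ , π₁ ∘ π₂ ⟩ φ ∧ π₁ ∘ π₂ ≐ π₂ ∘ π₂ ≤ reindex ⟨ π₁ , π₂ ∘ π₂ ⟩ φ
      δ-subst φ = proj₂ (∃e-adj φ (reindex ⟨ π₁ , π₂ ∘ π₂ ⟩ φ))
        (Fib.reflexive _ (Fib.Eq.sym _
          (Fib.Eq.trans _ (reindex-reindex drop-middle∘e≡id) (reindex-id φ))))
        where
        drop-middle∘e≡id : ⟨ π₁ , π₂ ∘ π₂ ⟩ ∘ e ≡ id
        drop-middle∘e≡id = ≡.trans ⟨⟩∘ (≡.trans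
          (cong₂ ⟨_,_⟩ (≡.trans π₁-β identityˡ)
                       (≡.trans (pullʳ π₂-β) (≡.trans (pullˡ π₂-β) identityˡ)))
          ⟨π₁,π₂⟩≡id)

  module _ {Z A : Obj} where
    open Fibre Z

    ≐-refl : (h : Z ⇒ A) {x : Carrier} → x ≤ h ≐ h
    ≐-refl h {x} = begin
      x                                    ≤⟨ maximum x ⟩
      ⊤                                    ≈⟨ Eq.sym (reindex-⊤ ⟨ id , h ⟩) ⟩
      reindex ⟨ id , h ⟩ (Fib.⊤ (Z ⊗₀ A))  ≤⟨ reindex-mono ⟨ id , h ⟩ ⊤≤π₂≐π₂ ⟩
      reindex ⟨ id , h ⟩ (π₂ ≐ π₂)         ≈⟨ reindex-≐ ⟨ id , h ⟩ π₂-β π₂-β ⟩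
      h ≐ h                                ∎

  module _ {Z A : Obj} where
    open Fibre Z

    ≐-subst : (φ : Fib.Carrier (Z ⊗₀ A)) (s t : Z ⇒ A) →
              reindex ⟨ id , s ⟩ φ ∧ s ≐ t ≤ reindex ⟨ id , t ⟩ φ
    ≐-subst φ s t = begin
      reindex ⟨ id , s ⟩ φ ∧ s ≐ t
        ≈⟨ Eq.sym (∧-cong (reindex-reindex (⟨π₁,π∘π₂⟩∘k π₁-β))
                          (reindex-≐ k (π∘π₂∘k π₁-β) (π∘π₂∘k π₂-β))) ⟩
      reindex k (reindex ⟨ π₁ , π₁ ∘ π₂ ⟩ φ) ∧ reindex k (π₁ ∘ π₂ ≐ π₂ ∘ π₂)
        ≤⟨ trans (reflexive (Eq.sym (reindex-∧ k _ _))) (reindex-mono k (δ-subst φ)) ⟩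
      reindex k (reindex ⟨ π₁ , π₂ ∘ π₂ ⟩ φ)
        ≈⟨ reindex-reindex (⟨π₁,π∘π₂⟩∘k π₂-β) ⟩
      reindex ⟨ id , t ⟩ φ
        ∎
      where
      k : Z ⇒ (Z ⊗₀ (A ⊗₀ A))
      k = ⟨ id , ⟨ s , t ⟩ ⟩
      π∘π₂∘k : ∀ {a} {π : (A ⊗₀ A) ⇒ A} → π ∘ ⟨ s , t ⟩ ≡ a → (π ∘ π₂) ∘ k ≡ a
      π∘π₂∘k πβ = ≡.trans (pullʳ π₂-β) πβ
      ⟨π₁,π∘π₂⟩∘k : ∀ {a} {π : (A ⊗₀ A) ⇒ A} → π ∘ ⟨ s , t ⟩ ≡ a → ⟨ π₁ , π ∘ π₂ ⟩ ∘ k ≡ ⟨ id , a ⟩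
      ⟨π₁,π∘π₂⟩∘k πβ = ≡.trans ⟨⟩∘ (cong₂ ⟨_,_⟩ π₁-β (π∘π₂∘k πβ))

    ≐-transport : ∀ {W} (u v : (Z ⊗₀ A) ⇒ W) (s t : Z ⇒ A) {a b c d : Z ⇒ W} →
                  u ∘ ⟨ id , s ⟩ ≡ a → v ∘ ⟨ id , s ⟩ ≡ b →
                  u ∘ ⟨ id , t ⟩ ≡ c → v ∘ ⟨ id , t ⟩ ≡ d →
                  a ≐ b ∧ s ≐ t ≤ c ≐ d
    ≐-transport u v s t {a} {b} {c} {d} us vs ut vt = begin
      a ≐ b ∧ s ≐ t                         ≈⟨ Eq.sym (∧-cong (reindex-≐ ⟨ id , s ⟩ us vs) Eq.refl) ⟩
      reindex ⟨ id , s ⟩ (u ≐ v) ∧ s ≐ t    ≤⟨ ≐-subst (u ≐ v) s t ⟩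
      reindex ⟨ id , t ⟩ (u ≐ v)            ≈⟨ reindex-≐ ⟨ id , t ⟩ ut vt ⟩
      c ≐ d                                 ∎

    ≐-trans : (s t u : Z ⇒ A) → s ≐ t ∧ t ≐ u ≤ s ≐ u
    ≐-trans s t u = ≐-transport (s ∘ π₁) π₂ t u ∘π₁-⟨id,⟩ π₂-β ∘π₁-⟨id,⟩ π₂-β

    ≐-cong : ∀ {B} (g : A ⇒ B) (s t : Z ⇒ A) → s ≐ t ≤ g ∘ s ≐ g ∘ t
    ≐-cong g s t = begin
      s ≐ t                      ≤⟨ ∧-greatest (≐-refl (g ∘ s)) refl ⟩
      g ∘ s ≐ g ∘ s ∧ s ≐ t      ≤⟨ ≐-transport ((g ∘ s) ∘ π₁) (g ∘ π₂) s t
                                      ∘π₁-⟨id,⟩ (pullʳ π₂-β) ∘π₁-⟨id,⟩ (pullʳ π₂-β) ⟩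
      g ∘ s ≐ g ∘ t              ∎

  module _ {Z B C : Obj} where
    open Fibre Z

    ≐-⟨⟩ : (s t : Z ⇒ (B ⊗₀ C)) → s ≐ t ≈ π₁ ∘ s ≐ π₁ ∘ t ∧ π₂ ∘ s ≐ π₂ ∘ t
    ≐-⟨⟩ s t = antisym (∧-greatest (≐-cong π₁ s t) (≐-cong π₂ s t)) (begin
      b ≐ b' ∧ d ≐ d'                    ≤⟨ ∧-monotonic (∧-greatest (≐-refl s) refl) refl ⟩
      (s ≐ s ∧ b ≐ b') ∧ d ≐ d'          ≡⟨ cong (λ r → (s ≐ r ∧ b ≐ b') ∧ d ≐ d') (≡.sym ⟨⟩-η) ⟩
      (s ≐ ⟨ b , d ⟩ ∧ b ≐ b') ∧ d ≐ d'  ≤⟨ ∧-monotonic (≐-transport (s ∘ π₁) ⟨ π₂ , d ∘ π₁ ⟩ b b'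
                                             ∘π₁-⟨id,⟩ first ∘π₁-⟨id,⟩ first) refl ⟩
      s ≐ ⟨ b' , d ⟩ ∧ d ≐ d'            ≤⟨ ≐-transport (s ∘ π₁) ⟨ b' ∘ π₁ , π₂ ⟩ d d'
                                             ∘π₁-⟨id,⟩ second ∘π₁-⟨id,⟩ second ⟩
      s ≐ ⟨ b' , d' ⟩                    ≡⟨ cong (s ≐_) ⟨⟩-η ⟩
      s ≐ t                              ∎)
      where
      b = π₁ ∘ s
      d = π₂ ∘ s
      b' = π₁ ∘ t
      d' = π₂ ∘ t
      first : ∀ {x : Z ⇒ B} → ⟨ π₂ , d ∘ π₁ ⟩ ∘ ⟨ id , x ⟩ ≡ ⟨ x , d ⟩
      first = ≡.trans ⟨⟩∘ (cong₂ ⟨_,_⟩ π₂-β ∘π₁-⟨id,⟩)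
      second : ∀ {x : Z ⇒ C} → ⟨ b' ∘ π₁ , π₂ ⟩ ∘ ⟨ id , x ⟩ ≡ ⟨ b' , x ⟩
      second = ≡.trans ⟨⟩∘ (cong₂ ⟨_,_⟩ ∘π₁-⟨id,⟩ π₂-β)

  Γ≡ : ∀ {X Y} (f : X ⇒ Y) → Γ f ≡ f ∘ π₁ ≐ π₂
  Γ≡ f = cong (λ r → f ∘ π₁ ≐ r) identityˡ

  module _ {W X Y : Obj} {u : W ⇒ (X ⊗₀ Y)} {a : W ⇒ X} {b : W ⇒ Y}
           (π₁u : π₁ ∘ u ≡ a) (π₂u : π₂ ∘ u ≡ b) where
    open Fibre W

    reindex-Γ : (f : X ⇒ Y) → reindex u (Γ f) ≈ f ∘ a ≐ b
    reindex-Γ f = reindex-≐ u (pullʳ π₁u) (≡.trans (pullʳ π₂u) identityˡ)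

  module _ {W X Y : Obj} {u : W ⇒ (Y ⊗₀ X)} {a : W ⇒ Y} {b : W ⇒ X}
           (π₁u : π₁ ∘ u ≡ a) (π₂u : π₂ ∘ u ≡ b) where
    open Fibre W

    reindex-Γ* : (f : X ⇒ Y) → reindex u (Γ* f) ≈ a ≐ f ∘ b
    reindex-Γ* f = reindex-≐ u (≡.trans (pullʳ π₁u) identityˡ) (pullʳ π₂u)

  module _ {A Y : Obj} where
    open Fibre A

    ∃₁-unit : (β : Fib.Carrier (A ⊗₀ Y)) → Fib._≤_ (A ⊗₀ Y) β (reindex π₁ (∃₁ β))
    ∃₁-unit β = proj₁ (∃₁-adj β (∃₁ β)) refl

    ∃₁-intro : (β : Fib.Carrier (A ⊗₀ Y)) (w : A ⇒ Y) → reindex ⟨ id , w ⟩ β ≤ ∃₁ β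
    ∃₁-intro β w = begin
      reindex ⟨ id , w ⟩ β                   ≤⟨ reindex-mono ⟨ id , w ⟩ (∃₁-unit β) ⟩
      reindex ⟨ id , w ⟩ (reindex π₁ (∃₁ β)) ≈⟨ reindex-reindex π₁-β ⟩
      reindex id (∃₁ β)                      ≈⟨ reindex-id (∃₁ β) ⟩
      ∃₁ β                                   ∎

    ∃₁-mono : {β β' : Fib.Carrier (A ⊗₀ Y)} → Fib._≤_ (A ⊗₀ Y) β β' → ∃₁ β ≤ ∃₁ β'
    ∃₁-mono {β} {β'} β≤β' = proj₂ (∃₁-adj β (∃₁ β')) (Fib.trans (A ⊗₀ Y) β≤β' (∃₁-unit β'))

  _⋈_ : ∀ {X Y Z} → Hom X Y → Hom Y Z → Fib.Carrier ((X ⊗₀ Z) ⊗₀ Y)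
  _⋈_ {X} {Y} {Z} f g =
    Fib._∧_ ((X ⊗₀ Z) ⊗₀ Y) (reindex ⟨ π₁ ∘ π₁ , π₂ ⟩ f) (reindex ⟨ π₂ , π₂ ∘ π₁ ⟩ g)

  module _ {X Y Z : Obj} where
    open Fibre (X ⊗₀ Z)

    ⨾-intro : (f : Hom X Y) (g : Hom Y Z) (w : (X ⊗₀ Z) ⇒ Y) {x : Carrier} →
              x ≤ reindex ⟨ π₁ , w ⟩ f → x ≤ reindex ⟨ w , π₂ ⟩ g → x ≤ f ⨾ g
    ⨾-intro f g w {x} x≤f x≤g = begin
      x                                                          ≤⟨ ∧-greatest x≤f x≤g ⟩
      reindex ⟨ π₁ , w ⟩ f ∧ reindex ⟨ w , π₂ ⟩ g
        ≈⟨ Eq.sym (∧-cong (reindex-reindex (≡.trans ⟨⟩∘ (cong₂ ⟨_,_⟩ ∘π₁-⟨id,⟩ π₂-β)))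
                   (reindex-reindex (≡.trans ⟨⟩∘ (cong₂ ⟨_,_⟩ π₂-β ∘π₁-⟨id,⟩)))) ⟩
      reindex ⟨ id , w ⟩ (reindex ⟨ π₁ ∘ π₁ , π₂ ⟩ f) ∧ reindex ⟨ id , w ⟩ (reindex ⟨ π₂ , π₂ ∘ π₁ ⟩ g)
        ≈⟨ Eq.sym (reindex-∧ ⟨ id , w ⟩ _ _) ⟩
      reindex ⟨ id , w ⟩ (f ⋈ g)
        ≤⟨ ∃₁-intro (f ⋈ g) w ⟩
      f ⨾ g                                                      ∎

    ⨾-elim : (f : Hom X Y) (g : Hom Y Z) (α : Carrier) →
             Fib._≤_ ((X ⊗₀ Z) ⊗₀ Y) (f ⋈ g) (reindex π₁ α) → f ⨾ g ≤ α
    ⨾-elim f g α = proj₂ (∃₁-adj (f ⋈ g) α)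

    ⨾-mono : {f f' : Hom X Y} {g g' : Hom Y Z} → f ≤ᴬ f' → g ≤ᴬ g' → f ⨾ g ≤ f' ⨾ g'
    ⨾-mono f≤f' g≤g' =
      ∃₁-mono (Fibre.∧-monotonic _ (reindex-mono _ f≤f') (reindex-mono _ g≤g'))

    ⨾-cong : {f f' : Hom X Y} {g g' : Hom Y Z} → f ≈ᴬ f' → g ≈ᴬ g' → f ⨾ g ≈ f' ⨾ g'
    ⨾-cong f≈f' g≈g' =
      antisym (⨾-mono (Fib.reflexive _ f≈f') (Fib.reflexive _ g≈g'))
              (⨾-mono (Fib.reflexive _ (Fib.Eq.sym _ f≈f')) (Fib.reflexive _ (Fib.Eq.sym _ g≈g')))

  ⊗-cong : ∀ {A B C D} {f f' : Hom A B} {g g' : Hom C D} → f ≈ᴬ f' → g ≈ᴬ g' →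
           f ⊗ᴬ g ≈ᴬ f' ⊗ᴬ g'
  ⊗-cong f≈f' g≈g' = Fibre.∧-cong _ (reindex-cong _ f≈f') (reindex-cong _ g≈g')

  Γ-id : ∀ {X} → Γ (id {X}) ≈ᴬ idᴬ X
  Γ-id {X} = begin-equality
    Γ id              ≡⟨ Γ≡ id ⟩
    id ∘ π₁ ≐ π₂      ≡⟨ cong (_≐ π₂) identityˡ ⟩
    π₁ ≐ π₂           ≈⟨ Eq.sym δ≈π₁≐π₂ ⟩
    δ X               ∎
    where open Fibre (X ⊗₀ X)

  module _ {X Y Z : Obj} (f : X ⇒ Y) (g : Y ⇒ Z) where

    Γ-∘-≤ : Γ (g ∘ f) ≤ᴬ Γ f ⨾ Γ g
    Γ-∘-≤ = ⨾-intro (Γ f) (Γ g) (f ∘ π₁)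
      (≤-respʳ-≈ (Eq.sym (reindex-Γ π₁-β π₂-β f)) (≐-refl (f ∘ π₁)))
      (begin
      Γ (g ∘ f)                     ≡⟨ Γ≡ (g ∘ f) ⟩
      (g ∘ f) ∘ π₁ ≐ π₂             ≡⟨ cong (_≐ π₂) assoc ⟩
      g ∘ f ∘ π₁ ≐ π₂               ≈⟨ Eq.sym (reindex-Γ π₁-β π₂-β g) ⟩
      reindex ⟨ f ∘ π₁ , π₂ ⟩ (Γ g) ∎)
      where open Fibre (X ⊗₀ Z)

    Γ-∘-≥ : Γ f ⨾ Γ g ≤ᴬ Γ (g ∘ f)
    Γ-∘-≥ = ⨾-elim (Γ f) (Γ g) (Γ (g ∘ f)) (begin
      Γ f ⋈ Γ g                                 ≈⟨ ∧-cong (reindex-Γ π₁-β π₂-β f) (reindex-Γ π₁-β π₂-β g) ⟩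
      f ∘ π₁ ∘ π₁ ≐ π₂ ∧ g ∘ π₂ ≐ π₂ ∘ π₁        ≤⟨ ∧-monotonic (≐-cong g _ _) refl ⟩
      g ∘ f ∘ π₁ ∘ π₁ ≐ g ∘ π₂ ∧ g ∘ π₂ ≐ π₂ ∘ π₁ ≤⟨ ≐-trans _ _ _ ⟩
      g ∘ f ∘ π₁ ∘ π₁ ≐ π₂ ∘ π₁                 ≡⟨ cong (_≐ π₂ ∘ π₁) assoc ⟨
      (g ∘ f) ∘ π₁ ∘ π₁ ≐ π₂ ∘ π₁               ≈⟨ Eq.sym (reindex-Γ ≡.refl ≡.refl (g ∘ f)) ⟩
      reindex π₁ (Γ (g ∘ f))                    ∎)
      where open Fibre ((X ⊗₀ Z) ⊗₀ Y)

  Γ-∘ : ∀ {X Y Z} (f : X ⇒ Y) (g : Y ⇒ Z) → Γ (g ∘ f) ≈ᴬ Γ f ⨾ Γ g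
  Γ-∘ f g = Fib.antisym _ (Γ-∘-≤ f g) (Γ-∘-≥ f g)

  Γ-⊗ : ∀ {A B C D} (f : A ⇒ B) (g : C ⇒ D) → Γ (f ⁂ g) ≈ᴬ Γ f ⊗ᴬ Γ g
  Γ-⊗ {A} {B} {C} {D} f g = begin-equality
    Γ (f ⁂ g)
      ≡⟨ Γ≡ (f ⁂ g) ⟩
    (f ⁂ g) ∘ π₁ ≐ π₂
      ≈⟨ ≐-⟨⟩ _ _ ⟩
    π₁ ∘ (f ⁂ g) ∘ π₁ ≐ π₁ ∘ π₂ ∧ π₂ ∘ (f ⁂ g) ∘ π₁ ≐ π₂ ∘ π₂
      ≡⟨ cong₂ (λ a b → a ≐ π₁ ∘ π₂ ∧ b ≐ π₂ ∘ π₂)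
               (≡.trans (pullˡ π₁-β) assoc) (≡.trans (pullˡ π₂-β) assoc) ⟩
    f ∘ π₁ ∘ π₁ ≐ π₁ ∘ π₂ ∧ g ∘ π₂ ∘ π₁ ≐ π₂ ∘ π₂
      ≈⟨ Eq.sym (∧-cong (reindex-Γ π₁-β π₂-β f) (reindex-Γ π₁-β π₂-β g)) ⟩
    Γ f ⊗ᴬ Γ g
      ∎
    where open Fibre ((A ⊗₀ C) ⊗₀ (B ⊗₀ D))

  module _ {X Y : Obj} (f : X ⇒ Y) where

    Γ⊣Γ*-unit : idᴬ X ≤ᴬ Γ f ⨾ Γ* f
    Γ⊣Γ*-unit = ⨾-intro (Γ f) (Γ* f) (f ∘ π₁)
      (≤-respʳ-≈ (Eq.sym (reindex-Γ π₁-β π₂-β f)) (≐-refl (f ∘ π₁)))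
      (begin
        δ X                               ≈⟨ δ≈π₁≐π₂ ⟩
        π₁ ≐ π₂                           ≤⟨ ≐-cong f π₁ π₂ ⟩
        f ∘ π₁ ≐ f ∘ π₂                   ≈⟨ Eq.sym (reindex-Γ* π₁-β π₂-β f) ⟩
        reindex ⟨ f ∘ π₁ , π₂ ⟩ (Γ* f)    ∎)
      where open Fibre (X ⊗₀ X)

    Γ⊣Γ*-counit : Γ* f ⨾ Γ f ≤ᴬ idᴬ Y
    Γ⊣Γ*-counit = ⨾-elim (Γ* f) (Γ f) (δ Y) (begin
      Γ* f ⋈ Γ f                          ≈⟨ ∧-cong (reindex-Γ* π₁-β π₂-β f) (reindex-Γ π₁-β π₂-β f) ⟩
      π₁ ∘ π₁ ≐ f ∘ π₂ ∧ f ∘ π₂ ≐ π₂ ∘ π₁ ≤⟨ ≐-trans _ _ _ ⟩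
      π₁ ∘ π₁ ≐ π₂ ∘ π₁                   ≈⟨ Eq.sym (reindex-≐ π₁ ≡.refl ≡.refl) ⟩
      reindex π₁ (π₁ ≐ π₂)                ≈⟨ Eq.sym (reindex-cong π₁ δ≈π₁≐π₂) ⟩
      reindex π₁ (δ Y)                    ∎)
      where open Fibre ((Y ⊗₀ Y) ⊗₀ X)

  Γ-isMap : ∀ {X Y} (f : X ⇒ Y) → IsMap (Γ f)
  Γ-isMap {X} {Y} f = copy-preserved , discard-preserved
    where
    copy-preserved : Γ f ⨾ dᴬ Y ≈ᴬ dᴬ X ⨾ (Γ f ⊗ᴬ Γ f)
    copy-preserved = begin-equality
      Γ f ⨾ Γ Δ           ≈⟨ Eq.sym (Γ-∘ f Δ) ⟩
      Γ (Δ ∘ f)           ≡⟨ cong Γ Δ-natural ⟩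
      Γ ((f ⁂ f) ∘ Δ)     ≈⟨ Γ-∘ Δ (f ⁂ f) ⟩
      Γ Δ ⨾ Γ (f ⁂ f)     ≈⟨ ⨾-cong (Fib.Eq.refl _) (Γ-⊗ f f) ⟩
      Γ Δ ⨾ (Γ f ⊗ᴬ Γ f)  ∎
      where open Fibre (X ⊗₀ (Y ⊗₀ Y))
    discard-preserved : Γ f ⨾ eᴬ Y ≈ᴬ eᴬ X
    discard-preserved = begin-equality
      Γ f ⨾ Γ !   ≈⟨ Eq.sym (Γ-∘ f !) ⟩
      Γ (! ∘ f)   ≡⟨ cong Γ !-uniq ⟩
      Γ !         ∎
      where open Fibre (X ⊗₀ I)

  Γ-π₁ : ∀ {A B} → Γ (π₁ {A} {B}) ≈ᴬ mapπ₁ A B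
  Γ-π₁ {A} {B} = begin-equality
    Γ π₁                     ≡⟨ cong Γ (≡.trans π₁-β identityˡ) ⟨
    Γ (π₁ ∘ (id ⁂ !))        ≈⟨ Γ-∘ (id ⁂ !) π₁ ⟩
    Γ (id ⁂ !) ⨾ Γ π₁        ≈⟨ ⨾-cong (Fib.Eq.trans _ (Γ-⊗ id !) (⊗-cong Γ-id (Fib.Eq.refl _)))
                                        (Fib.Eq.refl _) ⟩
    (δ A ⊗ᴬ Γ !) ⨾ Γ π₁      ∎
    where open Fibre ((A ⊗₀ B) ⊗₀ A)

  Γ-π₂ : ∀ {A B} → Γ (π₂ {A} {B}) ≈ᴬ mapπ₂ A B
  Γ-π₂ {A} {B} = begin-equality
    Γ π₂                     ≡⟨ cong Γ (≡.trans π₂-β identityˡ) ⟨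
    Γ (π₂ ∘ (! ⁂ id))        ≈⟨ Γ-∘ (! ⁂ id) π₂ ⟩
    Γ (! ⁂ id) ⨾ Γ π₂        ≈⟨ ⨾-cong (Fib.Eq.trans _ (Γ-⊗ ! id) (⊗-cong (Fib.Eq.refl _) Γ-id))
                                        (Fib.Eq.refl _) ⟩
    (Γ ! ⊗ᴬ δ B) ⨾ Γ π₂      ∎
    where open Fibre ((A ⊗₀ B) ⊗₀ B)

proposition6p1 : ∀ {o m p ℓ₁ ℓ₂ : Level} (𝒞 : CartesianCategory o m)
    (D : ElementaryExistentialDoctrine 𝒞 p ℓ₁ ℓ₂) →
    Relations.StrictMonoidalGraph D ×
    Relations.GraphRightAdjoints D ×
    Relations.StrictCartesianIntoMap D
proposition6p1 𝒞 D =
  (Γ-id , Γ-∘ , Γ-⊗) ,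
  (λ f → Γ⊣Γ*-unit f , Γ⊣Γ*-counit f) ,
  (Γ-isMap , Γ-π₁ , Γ-π₂ , Fibre.Eq.refl _)
  where open GraphFunctor D
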